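{- Let $k\in\mathbb{N}$. Then \[ \int_{\mathbb{Z}_p}\prod_{j=1}^{k}(1+jx)\,d\mu_1(x)=\sum_{n=0}^{k}k!\binom{H_k}{k-n}_{\mathbb{H}}B_n . \]
   Context: $p$ is an odd prime. For a polynomial $f:\mathbb{Z}_p\to\mathbb{C}_p$ the Volkenborn integral is $\int_{\mathbb{Z}_p} f(x)\,d\mu_1(x)=\lim_{N\to\infty}p^{ -N}\sum_{x=0}^{p^N-1}f(x)$. The harmonic binomial coefficient is $\binom{H_k}{m}_{\mathbb{H}}=\frac{1}{k!}{k+1\brack m+1}$, where ${a\brack b}$ denotes the unsigned Stirling number of the first kind (number of permutations of $a$ elements with exactly $b$ cycles). The Bernoulli numbers $B_n$ are defined by $\frac{t}{e^t-1}=\sum_{n\ge0}B_n\frac{t^n}{n!}$. -}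

module Defs where

open import Data.Nat as ℕ using (ℕ; zero; suc; _^_; _!)
open import Data.Nat.Combinatorics using (_C_)
open import Data.Integer as ℤ using (ℤ; +_)
open import Data.Integer.Divisibility as ℤD using ()
open import Data.Rational as ℚ using (ℚ; 0ℚ; 1ℚ; _+_; _*_; _-_; -_)
open import Data.List using (List; []; _∷_; _++_; [_]; foldr; map; upTo; lookup; length)
open import Data.Product using (Σ; ∃; _×_)
open import Relation.Binary.PropositionalEquality using (_≡_)
open import Relation.Nullary using (¬_)

ℕ→ℚ : ℕ → ℚ
ℕ→ℚ n = (+ n) ℚ./ 1

ℤ→ℚ : ℤ → ℚ
ℤ→ℚ z = z ℚ./ 1

-- reciprocal of a natural number (1/0 := 0, only used for nonzero arguments)
inv : ℕ → ℚ
inv zero    = 0ℚ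
inv (suc m) = (+ 1) ℚ./ suc m

Σ< : ℕ → (ℕ → ℚ) → ℚ
Σ< zero    f = 0ℚ
Σ< (suc n) f = Σ< n f + f n

Π1 : ℕ → (ℕ → ℚ) → ℚ
Π1 zero    g = 1ℚ
Π1 (suc k) g = Π1 k g * g (suc k)

-- Unsigned Stirling numbers of the first kind  [n, m]
-- (number of permutations of n elements with exactly m cycles),
-- via the standard recurrence [n+1, m+1] = n [n, m+1] + [n, m].
stirling1 : ℕ → ℕ → ℕ
stirling1 zero    zero    = 1
stirling1 zero    (suc m) = 0
stirling1 (suc n) zero    = 0
stirling1 (suc n) (suc m) = n ℕ.* stirling1 n (suc m) ℕ.+ stirling1 n m

-- Harmonic binomial coefficient  binom(H_k, m)_H = (1/k!) [k+1, m+1]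
harmBinom : ℕ → ℕ → ℚ
harmBinom k m = inv (k !) * ℕ→ℚ (stirling1 (suc k) (suc m))

-- Bernoulli numbers with t/(e^t - 1) = Σ B_n t^n / n!  (so B_1 = -1/2),
-- equivalently B_0 = 1 and Σ_{j=0}^{n} C(n+1, j) B_j = 0 for n ≥ 1.
-- bernList n = [B_0, ..., B_n]
private
  nth : List ℚ → ℕ → ℚ
  nth []       _       = 0ℚ
  nth (x ∷ xs) zero    = x
  nth (x ∷ xs) (suc i) = nth xs i

bernList : ℕ → List ℚ
bernList zero    = [ 1ℚ ]
bernList (suc n) =
  bernList n ++
  [ - (inv (suc (suc n)) * Σ< (suc n) (λ j → ℕ→ℚ (suc (suc n) C j) * nth (bernList n) j)) ]

bernoulli : ℕ → ℚ
bernoulli n = nth (bernList n) n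

-- p-adic valuation at least m:  q ∈ p^m ℤ_(p), i.e. q·b = p^m·a with p ∤ b
padicDivBy : (p m : ℕ) → ℚ → Set
padicDivBy p m q = Σ ℤ λ a → Σ ℤ λ b → (¬ ((+ p) ℤD.∣ b)) × (q * ℤ→ℚ b ≡ ℕ→ℚ (p ^ m) * ℤ→ℚ a)

PAdicLimit : (p : ℕ) → (ℕ → ℚ) → ℚ → Set
PAdicLimit p s L = ∀ (m : ℕ) → ∃ λ N₀ → ∀ N → N₀ ℕ.≤ N → padicDivBy p m (s N - L)

volkenbornSum : (p : ℕ) → (ℕ → ℚ) → ℕ → ℚ
volkenbornSum p f N = inv (p ^ N) * Σ< (p ^ N) f

VolkenbornIntegral : (p : ℕ) → (ℕ → ℚ) → ℚ → Set
VolkenbornIntegral p f L = PAdicLimit p (volkenbornSum p f) L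

-- Expanding (1 + x)(1 + 2x)⋯(1 + kx) = Σₙ [k+1, k+1-n] xⁿ and using k! binom(H_k, k-n) = [k+1, k+1-n],
-- the theorem reduces by linearity to ∫ xⁿ dμ₁ = Bₙ. For the Riemann sums Rₙ(N) = p^-N Σ_{x<p^N} xⁿ,
-- summing (x + 1)ⁿ⁺¹ - xⁿ⁺¹ over x < p^N telescopes to Σ_{j≤n} C(n+1, j) Rⱼ(N) = p^(Nn), which tends
-- p-adically to 0 for n ≥ 1. The Bernoulli numbers satisfy the same recurrence with right-hand side 0,
-- so Rₙ(N) → Bₙ by strong induction; dividing by n + 1 costs only v_p(n + 1) digits of precision.
module Submission where

open import Defs
open import Data.Nat using (ℕ; zero; suc)
open import Data.Nat.Primality using (Prime)

module RationalEmbedding where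
  open import Data.Nat as ℕ using (zero; suc)
  open import Data.Integer as ℤ using (+_; -[1+_])
  import Data.Integer.Properties as ℤP
  open import Data.Rational using (mkℚ; 1ℚ; _+_; _*_; -_)
  import Data.Rational.Properties as ℚP
  open import Data.Nat.Coprimality using (1-coprimeTo) renaming (sym to coprime-sym)
  open import Relation.Binary.PropositionalEquality

  ℤ→ℚ≡mkℚ : ∀ i → ℤ→ℚ i ≡ mkℚ i 0 (coprime-sym (1-coprimeTo _))
  ℤ→ℚ≡mkℚ (+ n)    = ℚP.normalize-coprime (coprime-sym (1-coprimeTo n))
  ℤ→ℚ≡mkℚ -[1+ n ] = cong -_ (ℚP.normalize-coprime (coprime-sym (1-coprimeTo (suc n))))

  ℤ→ℚ-+ : ∀ i j → ℤ→ℚ (i ℤ.+ j) ≡ ℤ→ℚ i + ℤ→ℚ j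
  ℤ→ℚ-+ i j rewrite ℤ→ℚ≡mkℚ i | ℤ→ℚ≡mkℚ j =
    cong₂ (λ x y → ℤ→ℚ (x ℤ.+ y)) (sym (ℤP.*-identityʳ i)) (sym (ℤP.*-identityʳ j))

  ℤ→ℚ-* : ∀ i j → ℤ→ℚ (i ℤ.* j) ≡ ℤ→ℚ i * ℤ→ℚ j
  ℤ→ℚ-* i j rewrite ℤ→ℚ≡mkℚ i | ℤ→ℚ≡mkℚ j = refl

  ℤ→ℚ-neg : ∀ i → ℤ→ℚ (ℤ.- i) ≡ - ℤ→ℚ i
  ℤ→ℚ-neg i rewrite ℤ→ℚ≡mkℚ i | ℤ→ℚ≡mkℚ (ℤ.- i) = mkℚ-neg i
    where
    mkℚ-neg : ∀ i → mkℚ (ℤ.- i) 0 (coprime-sym (1-coprimeTo _)) ≡ - mkℚ i 0 (coprime-sym (1-coprimeTo _))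
    mkℚ-neg (+ zero)  = refl
    mkℚ-neg (+ suc n) = refl
    mkℚ-neg -[1+ n ]  = refl

  ℕ→ℚ-+ : ∀ m n → ℕ→ℚ (m ℕ.+ n) ≡ ℕ→ℚ m + ℕ→ℚ n
  ℕ→ℚ-+ m n = trans (cong ℤ→ℚ (ℤP.pos-+ m n)) (ℤ→ℚ-+ (+ m) (+ n))

  ℕ→ℚ-* : ∀ m n → ℕ→ℚ (m ℕ.* n) ≡ ℕ→ℚ m * ℕ→ℚ n
  ℕ→ℚ-* m n = trans (cong ℤ→ℚ (ℤP.pos-* m n)) (ℤ→ℚ-* (+ m) (+ n))

  inv-inverseˡ : ∀ n .{{_ : ℕ.NonZero n}} → inv n * ℕ→ℚ n ≡ 1ℚ
  inv-inverseˡ (suc m) rewrite ℚP.normalize-coprime (1-coprimeTo (suc m)) | ℤ→ℚ≡mkℚ (+ suc m) =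
    ℚP.*-inverseˡ (mkℚ (+ suc m) 0 (coprime-sym (1-coprimeTo _)))

  inv-inverseʳ : ∀ n .{{_ : ℕ.NonZero n}} → ℕ→ℚ n * inv n ≡ 1ℚ
  inv-inverseʳ n = trans (ℚP.*-comm (ℕ→ℚ n) (inv n)) (inv-inverseˡ n)

  *-cancelˡ-ℕ→ℚ : ∀ n .{{_ : ℕ.NonZero n}} {x y} → ℕ→ℚ n * x ≡ ℕ→ℚ n * y → x ≡ y
  *-cancelˡ-ℕ→ℚ n {x} {y} eq = begin
    x                       ≡⟨ sym (ℚP.*-identityˡ x) ⟩
    1ℚ * x                  ≡⟨ cong (_* x) (sym (inv-inverseˡ n)) ⟩
    inv n * ℕ→ℚ n * x       ≡⟨ ℚP.*-assoc (inv n) (ℕ→ℚ n) x ⟩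
    inv n * (ℕ→ℚ n * x)     ≡⟨ cong (inv n *_) eq ⟩
    inv n * (ℕ→ℚ n * y)     ≡⟨ sym (ℚP.*-assoc (inv n) (ℕ→ℚ n) y) ⟩
    inv n * ℕ→ℚ n * y       ≡⟨ cong (_* y) (inv-inverseˡ n) ⟩
    1ℚ * y                  ≡⟨ ℚP.*-identityˡ y ⟩
    y                       ∎
    where
    open ≡-Reasoning

module NatCombinatorics where
  open import Data.Nat using (ℕ; zero; suc; _+_; _*_; _^_; _<_)
  open import Data.Nat.Properties
  open import Data.Nat.Combinatorics using (_C_; nCk+nC[k+1]≡[n+1]C[k+1]; k>n⇒nCk≡0; nCn≡1)
  open import Data.Nat.Solver using (module +-*-Solver)
  open import Relation.Binary.PropositionalEquality
  open +-*-Solver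
  open ≡-Reasoning

  Σℕ : ℕ → (ℕ → ℕ) → ℕ
  Σℕ zero    f = 0
  Σℕ (suc n) f = Σℕ n f + f n

  Σℕ-cong : ∀ n {f g : ℕ → ℕ} → (∀ j → j < n → f j ≡ g j) → Σℕ n f ≡ Σℕ n g
  Σℕ-cong zero    eq = refl
  Σℕ-cong (suc n) eq = cong₂ _+_ (Σℕ-cong n (λ j j<n → eq j (m<n⇒m<1+n j<n))) (eq n ≤-refl)

  Σℕ-distrib-+ : ∀ n (f g : ℕ → ℕ) → Σℕ n (λ j → f j + g j) ≡ Σℕ n f + Σℕ n g
  Σℕ-distrib-+ zero    f g = refl
  Σℕ-distrib-+ (suc n) f g rewrite Σℕ-distrib-+ n f g =
    solve 4 (λ a b c d → (a :+ b) :+ (c :+ d) := (a :+ c) :+ (b :+ d)) refl (Σℕ n f) (Σℕ n g) (f n) (g n)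

  Σℕ-distribˡ-* : ∀ n c (f : ℕ → ℕ) → c * Σℕ n f ≡ Σℕ n (λ j → c * f j)
  Σℕ-distribˡ-* zero    c f = *-zeroʳ c
  Σℕ-distribˡ-* (suc n) c f = trans (*-distribˡ-+ c (Σℕ n f) (f n)) (cong (_+ c * f n) (Σℕ-distribˡ-* n c f))

  Σℕ-unfoldˡ : ∀ n (f : ℕ → ℕ) → Σℕ (suc n) f ≡ f 0 + Σℕ n (λ j → f (suc j))
  Σℕ-unfoldˡ zero    f = +-comm 0 (f 0)
  Σℕ-unfoldˡ (suc n) f rewrite Σℕ-unfoldˡ n f = +-assoc (f 0) (Σℕ n (λ j → f (suc j))) (f (suc n))

  Σ[aₙxⁿ]*[1+cx] : ∀ k c x (a b : ℕ → ℕ) → a (suc k) ≡ 0 → b 0 ≡ a 0 →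
                   (∀ n → b (suc n) ≡ a (suc n) + c * a n) →
                   Σℕ (suc k) (λ n → a n * x ^ n) * (1 + c * x) ≡ Σℕ (suc (suc k)) (λ n → b n * x ^ n)
  Σ[aₙxⁿ]*[1+cx] k c x a b a[k+1]≡0 b₀≡a₀ b-rec = sym (begin
    Σℕ (suc (suc k)) (λ n → b n * x ^ n)
      ≡⟨ Σℕ-unfoldˡ (suc k) _ ⟩
    b 0 * 1 + Σℕ (suc k) (λ n → b (suc n) * x ^ suc n)
      ≡⟨ cong₂ _+_ (cong (_* 1) b₀≡a₀) (Σℕ-cong (suc k) (λ n _ → shifted n)) ⟩
    a 0 * 1 + Σℕ (suc k) (λ n → a (suc n) * x ^ suc n + c * x * (a n * x ^ n))
      ≡⟨ cong (a 0 * 1 +_) (Σℕ-distrib-+ (suc k) _ _) ⟩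
    a 0 * 1 + (Σℕ (suc k) (λ n → a (suc n) * x ^ suc n) + Σℕ (suc k) (λ n → c * x * (a n * x ^ n)))
      ≡⟨ sym (+-assoc (a 0 * 1) _ _) ⟩
    a 0 * 1 + Σℕ (suc k) (λ n → a (suc n) * x ^ suc n) + Σℕ (suc k) (λ n → c * x * (a n * x ^ n))
      ≡⟨ cong (_+ Σℕ (suc k) (λ n → c * x * (a n * x ^ n))) (sym (Σℕ-unfoldˡ (suc k) _)) ⟩
    Σℕ (suc (suc k)) (λ n → a n * x ^ n) + Σℕ (suc k) (λ n → c * x * (a n * x ^ n))
      ≡⟨ cong₂ _+_ (cong (λ u → A + u * x ^ suc k) a[k+1]≡0) (sym (Σℕ-distribˡ-* (suc k) (c * x) _)) ⟩
    A + 0 + c * x * A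
      ≡⟨ solve 3 (λ A c x → A :+ con 0 :+ c :* x :* A := A :* (con 1 :+ c :* x)) refl A c x ⟩
    A * (1 + c * x) ∎)
    where
    A = Σℕ (suc k) (λ n → a n * x ^ n)
    shifted : ∀ n → b (suc n) * x ^ suc n ≡ a (suc n) * x ^ suc n + c * x * (a n * x ^ n)
    shifted n rewrite b-rec n =
      solve 5 (λ a₁ a₀ c x y → (a₁ :+ c :* a₀) :* (x :* y) := a₁ :* (x :* y) :+ c :* x :* (a₀ :* y)) refl
        (a (suc n)) (a n) c x (x ^ n)

  Σ[nCj*xʲ]≡[1+x]ⁿ : ∀ n x → Σℕ (suc n) (λ j → (n C j) * x ^ j) ≡ suc x ^ n
  Σ[nCj*xʲ]≡[1+x]ⁿ zero    x = refl
  Σ[nCj*xʲ]≡[1+x]ⁿ (suc n) x = begin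
    Σℕ (suc (suc n)) (λ j → (suc n C j) * x ^ j)
      ≡⟨ sym (Σ[aₙxⁿ]*[1+cx] n 1 x (n C_) (suc n C_) (k>n⇒nCk≡0 (n<1+n n)) refl pascal) ⟩
    Σℕ (suc n) (λ j → (n C j) * x ^ j) * (1 + 1 * x)
      ≡⟨ cong₂ _*_ (Σ[nCj*xʲ]≡[1+x]ⁿ n x) (cong suc (*-identityˡ x)) ⟩
    suc x ^ n * suc x
      ≡⟨ *-comm (suc x ^ n) (suc x) ⟩
    suc x ^ suc n ∎
    where
    pascal : ∀ j → suc n C suc j ≡ n C suc j + 1 * (n C j)
    pascal j = trans (sym (nCk+nC[k+1]≡[n+1]C[k+1] n j))
                     (trans (+-comm (n C j) _) (cong (n C suc j +_) (sym (*-identityˡ _))))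

  Σ[[n+1]Cj*Σxʲ]≡Mⁿ⁺¹ : ∀ n M → Σℕ (suc n) (λ j → (suc n C j) * Σℕ M (λ x → x ^ j)) ≡ M ^ suc n
  Σ[[n+1]Cj*Σxʲ]≡Mⁿ⁺¹ n zero = trans (Σℕ-cong (suc n) (λ j _ → *-zeroʳ (suc n C j))) (Σℕ-zero (suc n))
    where
    Σℕ-zero : ∀ K → Σℕ K (λ _ → 0) ≡ 0
    Σℕ-zero zero    = refl
    Σℕ-zero (suc K) = trans (+-identityʳ _) (Σℕ-zero K)
  Σ[[n+1]Cj*Σxʲ]≡Mⁿ⁺¹ n (suc M) = begin
    Σℕ (suc n) (λ j → (suc n C j) * (Σℕ M (λ x → x ^ j) + M ^ j))
      ≡⟨ Σℕ-cong (suc n) (λ j _ → *-distribˡ-+ (suc n C j) _ (M ^ j)) ⟩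
    Σℕ (suc n) (λ j → (suc n C j) * Σℕ M (λ x → x ^ j) + (suc n C j) * M ^ j)
      ≡⟨ Σℕ-distrib-+ (suc n) _ _ ⟩
    Σℕ (suc n) (λ j → (suc n C j) * Σℕ M (λ x → x ^ j)) + Σℕ (suc n) (λ j → (suc n C j) * M ^ j)
      ≡⟨ cong (_+ Σℕ (suc n) (λ j → (suc n C j) * M ^ j)) (Σ[[n+1]Cj*Σxʲ]≡Mⁿ⁺¹ n M) ⟩
    M ^ suc n + Σℕ (suc n) (λ j → (suc n C j) * M ^ j)
      ≡⟨ +-comm (M ^ suc n) _ ⟩
    Σℕ (suc n) (λ j → (suc n C j) * M ^ j) + M ^ suc n
      ≡⟨ cong (Σℕ (suc n) (λ j → (suc n C j) * M ^ j) +_)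
              (sym (trans (cong (_* M ^ suc n) (nCn≡1 (suc n))) (*-identityˡ _))) ⟩
    Σℕ (suc (suc n)) (λ j → (suc n C j) * M ^ j)
      ≡⟨ Σ[nCj*xʲ]≡[1+x]ⁿ (suc n) M ⟩
    suc M ^ suc n ∎

module StirlingCoefficients where
  open import Data.Nat using (ℕ; zero; suc; _+_; _*_; _<_; _∸_; s≤s; _≤?_)
  open import Data.Nat.Properties
  open import Relation.Nullary using (yes; no)
  open import Relation.Binary.PropositionalEquality

  stirling1-vanishes : ∀ {n m} → n < m → stirling1 n m ≡ 0
  stirling1-vanishes {zero}  {suc m} _ = refl
  stirling1-vanishes {suc n} {suc m} (s≤s n<m)
    rewrite stirling1-vanishes (m<n⇒m<1+n n<m) | stirling1-vanishes n<m | *-zeroʳ n = refl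

  stirling1-diagonal : ∀ n → stirling1 n n ≡ 1
  stirling1-diagonal zero = refl
  stirling1-diagonal (suc n) rewrite stirling1-vanishes (n<1+n n) | stirling1-diagonal n | *-zeroʳ n = refl

  stirlingCoeff : ℕ → ℕ → ℕ
  stirlingCoeff k n = stirling1 (suc k) (suc k ∸ n)

  stirlingCoeff-constant : ∀ k → stirlingCoeff k 0 ≡ 1
  stirlingCoeff-constant k = stirling1-diagonal (suc k)

  stirlingCoeff-beyond-degree : ∀ k → stirlingCoeff k (suc k) ≡ 0
  stirlingCoeff-beyond-degree k rewrite n∸n≡0 k = refl

  stirlingCoeff-rec : ∀ k n → stirlingCoeff (suc k) (suc n) ≡ stirlingCoeff k (suc n) + suc k * stirlingCoeff k n
  stirlingCoeff-rec k n with n ≤? k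
  ... | yes n≤k rewrite +-∸-assoc 1 n≤k = +-comm (suc k * stirling1 (suc k) (suc (k ∸ n))) _
  ... | no n≰k rewrite m≤n⇒m∸n≡0 (≰⇒> n≰k) | m≤n⇒m∸n≡0 (<⇒≤ (≰⇒> n≰k)) | *-zeroʳ k = refl

module RationalSums where
  open import Data.Nat using (ℕ; zero; suc; _<_)
  import Data.Nat.Properties as ℕP
  open import Data.Rational using (ℚ; 0ℚ; _+_; _*_)
  import Data.Rational.Properties as ℚP
  open import Data.Rational.Solver using (module +-*-Solver)
  open import Relation.Binary.PropositionalEquality
  open +-*-Solver
  open RationalEmbedding
  open NatCombinatorics using (Σℕ)

  Σ<-cong : ∀ n {f g : ℕ → ℚ} → (∀ j → j < n → f j ≡ g j) → Σ< n f ≡ Σ< n g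
  Σ<-cong zero    eq = refl
  Σ<-cong (suc n) eq = cong₂ _+_ (Σ<-cong n (λ j j<n → eq j (ℕP.m<n⇒m<1+n j<n))) (eq n ℕP.≤-refl)

  Σ<-zero : ∀ n → Σ< n (λ _ → 0ℚ) ≡ 0ℚ
  Σ<-zero zero    = refl
  Σ<-zero (suc n) = trans (ℚP.+-identityʳ _) (Σ<-zero n)

  Σ<-distrib-+ : ∀ n (f g : ℕ → ℚ) → Σ< n (λ j → f j + g j) ≡ Σ< n f + Σ< n g
  Σ<-distrib-+ zero    f g = sym (ℚP.+-identityʳ 0ℚ)
  Σ<-distrib-+ (suc n) f g rewrite Σ<-distrib-+ n f g =
    solve 4 (λ a b c d → (a :+ b) :+ (c :+ d) := (a :+ c) :+ (b :+ d)) refl (Σ< n f) (Σ< n g) (f n) (g n)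

  Σ<-distribˡ-* : ∀ n c (f : ℕ → ℚ) → c * Σ< n f ≡ Σ< n (λ j → c * f j)
  Σ<-distribˡ-* zero    c f = ℚP.*-zeroʳ c
  Σ<-distribˡ-* (suc n) c f = trans (ℚP.*-distribˡ-+ c (Σ< n f) (f n)) (cong (_+ c * f n) (Σ<-distribˡ-* n c f))

  Σ<-comm : ∀ m n (f : ℕ → ℕ → ℚ) → Σ< m (λ i → Σ< n (λ j → f j i)) ≡ Σ< n (λ j → Σ< m (f j))
  Σ<-comm zero    n f = sym (Σ<-zero n)
  Σ<-comm (suc m) n f rewrite Σ<-comm m n f = sym (Σ<-distrib-+ n (λ j → Σ< m (f j)) (λ j → f j m))

  ℕ→ℚ-Σℕ : ∀ n f → ℕ→ℚ (Σℕ n f) ≡ Σ< n (λ j → ℕ→ℚ (f j))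
  ℕ→ℚ-Σℕ zero    f = refl
  ℕ→ℚ-Σℕ (suc n) f = trans (ℕ→ℚ-+ (Σℕ n f) (f n)) (cong (_+ ℕ→ℚ (f n)) (ℕ→ℚ-Σℕ n f))

module BernoulliNumbers where
  open import Data.Nat as ℕ using (ℕ; zero; suc; _≤_; _<_; z≤n; s≤s)
  import Data.Nat.Properties as ℕP
  open import Data.Nat.Combinatorics using (_C_; nCk≡nC[n∸k]; nC1≡n)
  open import Data.Rational using (ℚ; 0ℚ; 1ℚ; _+_; _*_; _-_; -_)
  open import Data.Rational.Solver using (module +-*-Solver)
  open import Data.List using (List; []; _∷_; _++_; [_]; length)
  import Data.List.Properties as ListP
  open import Data.Sum using (inj₁; inj₂)
  open import Relation.Binary.PropositionalEquality hiding ([_])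
  open +-*-Solver
  open RationalEmbedding
  open RationalSums

  -- The list indexing used by Defs is private; unification recovers it from the
  -- definition of bernoulli once bernList n is abstracted to a variable.
  mutual
    nth : List ℚ → ℕ → ℚ
    nth = _

    nth-bernList : ∀ n → nth (bernList n) n ≡ bernoulli n
    nth-bernList n with bernList n
    ... | xs = refl

  nth-++ : ∀ xs ys {j} → j < length xs → nth (xs ++ ys) j ≡ nth xs j
  nth-++ (x ∷ xs) ys {zero}  _         = refl
  nth-++ (x ∷ xs) ys {suc j} (s≤s j<n) = nth-++ xs ys j<n

  nth-last : ∀ xs y → nth (xs ++ [ y ]) (length xs) ≡ y
  nth-last []       y = refl
  nth-last (x ∷ xs) y = nth-last xs y

  length-bernList : ∀ n → length (bernList n) ≡ suc n
  length-bernList zero    = refl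
  length-bernList (suc n) =
    trans (ListP.length-++ (bernList n)) (trans (cong (ℕ._+ 1) (length-bernList n)) (ℕP.+-comm (suc n) 1))

  nth-bernList-prefix : ∀ n {j} → j ≤ n → nth (bernList n) j ≡ bernoulli j
  nth-bernList-prefix zero    z≤n = refl
  nth-bernList-prefix (suc n) j≤n with ℕP.m≤n⇒m<n∨m≡n j≤n
  ... | inj₂ refl = nth-bernList (suc n)
  ... | inj₁ j<n  = trans (nth-++ (bernList n) _ (subst (_ <_) (sym (length-bernList n)) j<n))
                          (nth-bernList-prefix n (ℕP.≤-pred j<n))

  bernoulli-suc : ∀ n → bernoulli (suc n) ≡
    - (inv (suc (suc n)) * Σ< (suc n) (λ j → ℕ→ℚ (suc (suc n) C j) * bernoulli j))
  bernoulli-suc n = begin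
    bernoulli (suc n)                         ≡⟨ sym (nth-bernList (suc n)) ⟩
    nth (bernList n ++ [ last ]) (suc n)      ≡⟨ subst (λ l → nth (bernList n ++ [ last ]) l ≡ last)
                                                       (length-bernList n) (nth-last (bernList n) last) ⟩
    - (inv c * S (nth (bernList n)))          ≡⟨ cong (λ s → - (inv c * s)) (Σ<-cong (suc n) prefix) ⟩
    - (inv c * S bernoulli)                   ∎
    where
    open ≡-Reasoning
    c = suc (suc n)
    S : (ℕ → ℚ) → ℚ
    S b = Σ< (suc n) (λ j → ℕ→ℚ (c C j) * b j)
    last = - (inv c * S (nth (bernList n)))
    prefix : ∀ j → j < suc n → ℕ→ℚ (c C j) * nth (bernList n) j ≡ ℕ→ℚ (c C j) * bernoulli j
    prefix j j<n+1 = cong (ℕ→ℚ (c C j) *_) (nth-bernList-prefix n (ℕP.≤-pred j<n+1))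

  [n+1]Cn≡n+1 : ∀ n → suc n C n ≡ suc n
  [n+1]Cn≡n+1 n =
    trans (nCk≡nC[n∸k] (ℕP.n≤1+n n)) (trans (cong (suc n C_) (ℕP.m+n∸n≡m 1 n)) (nC1≡n (suc n)))

  Σ[[n+2]Cj*Bⱼ]≡0 : ∀ n → Σ< (suc (suc n)) (λ j → ℕ→ℚ (suc (suc n) C j) * bernoulli j) ≡ 0ℚ
  Σ[[n+2]Cj*Bⱼ]≡0 n rewrite [n+1]Cn≡n+1 (suc n) | bernoulli-suc n = begin
    S + c * (- (inv c′ * S))
      ≡⟨ solve 3 (λ S c i → S :+ c :* (:- (i :* S)) := S :- (i :* c) :* S) refl S c (inv c′) ⟩
    S - (inv c′ * c) * S
      ≡⟨ cong (λ u → S - u * S) (inv-inverseˡ c′) ⟩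
    S - 1ℚ * S
      ≡⟨ solve 1 (λ S → S :- con 1ℚ :* S := con 0ℚ) refl S ⟩
    0ℚ ∎
    where
    open ≡-Reasoning
    c′ = suc (suc n)
    c  = ℕ→ℚ c′
    S  = Σ< (suc n) (λ j → ℕ→ℚ (suc (suc n) C j) * bernoulli j)

module PAdicValuation (p : ℕ) (p-prime : Prime p) where
  open import Data.Nat as ℕ using (_≤_; _<_; _∸_; _^_; s≤s; z≤n)
  import Data.Nat.Properties as ℕP
  open import Data.Nat.Divisibility as ℕD using (divides; _∣?_; _∤_)
  open import Data.Nat.Induction using (<-rec)
  open import Data.Nat.Primality using (euclidsLemma; prime⇒nonZero; prime⇒nonTrivial; ¬prime[1])
  open import Data.Integer as ℤ using (+_)
  import Data.Integer.Properties as ℤP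
  open import Data.Integer.Divisibility as ℤD using ()
  open import Data.Rational using (0ℚ; 1ℚ; _+_; _*_; -_)
  import Data.Rational.Properties as ℚP
  open import Data.Rational.Solver using (module +-*-Solver)
  open import Data.Product using (∃₂; _×_; _,_)
  open import Data.Sum using (inj₁; inj₂)
  open import Data.Empty using (⊥-elim)
  open import Relation.Nullary using (¬_; yes; no)
  open import Relation.Binary.PropositionalEquality
  open +-*-Solver
  open RationalEmbedding

  pᵉ≢0 : ∀ e → ℕ.NonZero (p ^ e)
  pᵉ≢0 e = ℕP.m^n≢0 p e {{prime⇒nonZero p-prime}}

  1<p : 1 < p
  1<p = ℕ.nonTrivial⇒n>1 p {{prime⇒nonTrivial p-prime}}

  p∤1 : ¬ (+ p) ℤD.∣ (+ 1)
  p∤1 p∣1 = ¬prime[1] (subst Prime (ℕD.∣1⇒≡1 p∣1) p-prime)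

  p∤-* : ∀ b b′ → ¬ (+ p) ℤD.∣ b → ¬ (+ p) ℤD.∣ b′ → ¬ (+ p) ℤD.∣ (b ℤ.* b′)
  p∤-* b b′ p∤b p∤b′ p∣bb′
    with euclidsLemma ℤ.∣ b ∣ ℤ.∣ b′ ∣ p-prime (subst (p ℕD.∣_) (ℤP.abs-* b b′) p∣bb′)
  ... | inj₁ p∣b  = p∤b p∣b
  ... | inj₂ p∣b′ = p∤b′ p∣b′

  p-power-split : ∀ c → 0 < c → ∃₂ λ s t → c ≡ p ^ s ℕ.* t × p ∤ t
  p-power-split = <-rec _ split
    where
    split : ∀ c → (∀ {c′} → c′ < c → 0 < c′ → ∃₂ λ s t → c′ ≡ p ^ s ℕ.* t × p ∤ t) →
            0 < c → ∃₂ λ s t → c ≡ p ^ s ℕ.* t × p ∤ t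
    split c rec c>0 with p ∣? c
    ... | no p∤c = 0 , c , sym (ℕP.*-identityˡ c) , p∤c
    ... | yes (divides zero c≡0) = ⊥-elim (ℕP.<⇒≢ c>0 (sym c≡0))
    ... | yes (divides q@(suc _) c≡q*p) with rec (subst (q <_) (sym c≡q*p) (ℕP.m<m*n q p 1<p)) (s≤s z≤n)
    ...   | s , t , q≡pˢt , p∤t =
      suc s , t , trans c≡q*p (trans (cong (ℕ._* p) q≡pˢt) (reassoc (p ^ s) t)) , p∤t
      where
      reassoc : ∀ a t → a ℕ.* t ℕ.* p ≡ p ℕ.* a ℕ.* t
      reassoc a t = trans (ℕP.*-comm (a ℕ.* t) p) (sym (ℕP.*-assoc p a t))

  padicDivBy-0 : ∀ m → padicDivBy p m 0ℚ
  padicDivBy-0 m = + 0 , + 1 , p∤1 , trans (ℚP.*-zeroˡ 1ℚ) (sym (ℚP.*-zeroʳ (ℕ→ℚ (p ^ m))))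

  padicDivBy-p^ : ∀ m e → m ≤ e → padicDivBy p m (ℕ→ℚ (p ^ e))
  padicDivBy-p^ m e m≤e = + (p ^ (e ∸ m)) , + 1 , p∤1 , (begin
    ℕ→ℚ (p ^ e) * 1ℚ                     ≡⟨ ℚP.*-identityʳ _ ⟩
    ℕ→ℚ (p ^ e)                          ≡⟨ cong (λ e → ℕ→ℚ (p ^ e)) (sym (ℕP.m+[n∸m]≡n m≤e)) ⟩
    ℕ→ℚ (p ^ (m ℕ.+ (e ∸ m)))            ≡⟨ cong ℕ→ℚ (ℕP.^-distribˡ-+-* p m (e ∸ m)) ⟩
    ℕ→ℚ (p ^ m ℕ.* p ^ (e ∸ m))          ≡⟨ ℕ→ℚ-* (p ^ m) (p ^ (e ∸ m)) ⟩
    ℕ→ℚ (p ^ m) * ℕ→ℚ (p ^ (e ∸ m))      ∎)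
    where open ≡-Reasoning

  padicDivBy-+ : ∀ m q r → padicDivBy p m q → padicDivBy p m r → padicDivBy p m (q + r)
  padicDivBy-+ m q r (a , b , p∤b , qb≡Pa) (a′ , b′ , p∤b′ , rb′≡Pa′) =
    a ℤ.* b′ ℤ.+ a′ ℤ.* b , b ℤ.* b′ , p∤-* b b′ p∤b p∤b′ , (begin
      (q + r) * ℤ→ℚ (b ℤ.* b′)
        ≡⟨ cong ((q + r) *_) (ℤ→ℚ-* b b′) ⟩
      (q + r) * (B * B′)
        ≡⟨ solve 4 (λ q r B B′ → (q :+ r) :* (B :* B′) := q :* B :* B′ :+ r :* B′ :* B) refl q r B B′ ⟩
      q * B * B′ + r * B′ * B
        ≡⟨ cong₂ (λ u v → u * B′ + v * B) qb≡Pa rb′≡Pa′ ⟩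
      P * A * B′ + P * A′ * B
        ≡⟨ solve 5 (λ P A B′ A′ B → P :* A :* B′ :+ P :* A′ :* B := P :* (A :* B′ :+ A′ :* B)) refl P A B′ A′ B ⟩
      P * (A * B′ + A′ * B)
        ≡⟨ cong (P *_) (sym (trans (ℤ→ℚ-+ (a ℤ.* b′) (a′ ℤ.* b)) (cong₂ _+_ (ℤ→ℚ-* a b′) (ℤ→ℚ-* a′ b)))) ⟩
      P * ℤ→ℚ (a ℤ.* b′ ℤ.+ a′ ℤ.* b) ∎)
    where
    open ≡-Reasoning
    P = ℕ→ℚ (p ^ m)
    A = ℤ→ℚ a
    A′ = ℤ→ℚ a′
    B = ℤ→ℚ b
    B′ = ℤ→ℚ b′

  padicDivBy-*ˡ : ∀ m z q → padicDivBy p m q → padicDivBy p m (ℤ→ℚ z * q)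
  padicDivBy-*ˡ m z q (a , b , p∤b , qb≡Pa) = z ℤ.* a , b , p∤b , (begin
    ℤ→ℚ z * q * ℤ→ℚ b       ≡⟨ ℚP.*-assoc (ℤ→ℚ z) q (ℤ→ℚ b) ⟩
    ℤ→ℚ z * (q * ℤ→ℚ b)     ≡⟨ cong (ℤ→ℚ z *_) qb≡Pa ⟩
    ℤ→ℚ z * (P * ℤ→ℚ a)     ≡⟨ ℚP.*-comm (ℤ→ℚ z) (P * ℤ→ℚ a) ⟩
    P * ℤ→ℚ a * ℤ→ℚ z       ≡⟨ ℚP.*-assoc P (ℤ→ℚ a) (ℤ→ℚ z) ⟩
    P * (ℤ→ℚ a * ℤ→ℚ z)     ≡⟨ cong (P *_) (ℚP.*-comm (ℤ→ℚ a) (ℤ→ℚ z)) ⟩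
    P * (ℤ→ℚ z * ℤ→ℚ a)     ≡⟨ cong (P *_) (sym (ℤ→ℚ-* z a)) ⟩
    P * ℤ→ℚ (z ℤ.* a)       ∎)
    where
    open ≡-Reasoning
    P = ℕ→ℚ (p ^ m)

  padicDivBy-neg : ∀ m q → padicDivBy p m q → padicDivBy p m (- q)
  padicDivBy-neg m q (a , b , p∤b , qb≡Pa) = ℤ.- a , b , p∤b , (begin
    - q * ℤ→ℚ b             ≡⟨ solve 2 (λ q B → (:- q) :* B := :- (q :* B)) refl q (ℤ→ℚ b) ⟩
    - (q * ℤ→ℚ b)           ≡⟨ cong -_ qb≡Pa ⟩
    - (P * ℤ→ℚ a)           ≡⟨ solve 2 (λ P A → :- (P :* A) := P :* (:- A)) refl P (ℤ→ℚ a) ⟩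
    P * - ℤ→ℚ a             ≡⟨ cong (P *_) (sym (ℤ→ℚ-neg a)) ⟩
    P * ℤ→ℚ (ℤ.- a)         ∎)
    where
    open ≡-Reasoning
    P = ℕ→ℚ (p ^ m)

  padicDivBy-cancel : ∀ m s t q → p ∤ t →
                      padicDivBy p (m ℕ.+ s) (ℕ→ℚ (p ^ s ℕ.* t) * q) → padicDivBy p m q
  padicDivBy-cancel m s t q p∤t (a , b , p∤b , eq) = a , + t ℤ.* b , p∤-* (+ t) b p∤t p∤b ,
    *-cancelˡ-ℕ→ℚ (p ^ s) {{pᵉ≢0 s}} (begin
      Pₛ * (q * ℤ→ℚ (+ t ℤ.* b))       ≡⟨ cong (λ u → Pₛ * (q * u)) (ℤ→ℚ-* (+ t) b) ⟩
      Pₛ * (q * (T * B))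
        ≡⟨ solve 4 (λ Pₛ q T B → Pₛ :* (q :* (T :* B)) := Pₛ :* T :* q :* B) refl Pₛ q T B ⟩
      Pₛ * T * q * B                   ≡⟨ cong (λ u → u * q * B) (sym (ℕ→ℚ-* (p ^ s) t)) ⟩
      ℕ→ℚ (p ^ s ℕ.* t) * q * B        ≡⟨ eq ⟩
      ℕ→ℚ (p ^ (m ℕ.+ s)) * A
        ≡⟨ cong (_* A) (trans (cong ℕ→ℚ (ℕP.^-distribˡ-+-* p m s)) (ℕ→ℚ-* (p ^ m) (p ^ s))) ⟩
      Pₘ * Pₛ * A
        ≡⟨ solve 3 (λ Pₘ Pₛ A → Pₘ :* Pₛ :* A := Pₛ :* (Pₘ :* A)) refl Pₘ Pₛ A ⟩
      Pₛ * (Pₘ * A)                    ∎)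
    where
    open ≡-Reasoning
    Pₘ = ℕ→ℚ (p ^ m)
    Pₛ = ℕ→ℚ (p ^ s)
    T = ℕ→ℚ t
    A = ℤ→ℚ a
    B = ℤ→ℚ b

module PAdicLimits (p : ℕ) (p-prime : Prime p) where
  open import Data.Nat as ℕ using (_<_; _⊔_; _^_)
  import Data.Nat.Properties as ℕP
  open import Data.Rational using (ℚ; 0ℚ; _+_; _*_; _-_; -_)
  import Data.Rational.Properties as ℚP
  open import Data.Rational.Solver using (module +-*-Solver)
  open import Data.Product using (_,_)
  open import Relation.Binary.PropositionalEquality
  open +-*-Solver
  open RationalEmbedding
  open PAdicValuation p p-prime

  PAdicLimit-cong : ∀ {s t} L → (∀ N → s N ≡ t N) → PAdicLimit p s L → PAdicLimit p t L
  PAdicLimit-cong L s≡t s→L m with s→L m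
  ... | N₀ , close = N₀ , λ N N₀≤N → subst (λ u → padicDivBy p m (u - L)) (s≡t N) (close N N₀≤N)

  PAdicLimit-const : ∀ L → PAdicLimit p (λ _ → L) L
  PAdicLimit-const L m = 0 , λ _ _ → subst (padicDivBy p m) (sym (ℚP.+-inverseʳ L)) (padicDivBy-0 m)

  PAdicLimit-+ : ∀ s L t M → PAdicLimit p s L → PAdicLimit p t M → PAdicLimit p (λ N → s N + t N) (L + M)
  PAdicLimit-+ s L t M s→L t→M m with s→L m | t→M m
  ... | N₁ , close₁ | N₂ , close₂ = N₁ ⊔ N₂ , λ N N₀≤N →
    subst (padicDivBy p m) (regroup (s N) (t N))
      (padicDivBy-+ m (s N - L) (t N - M) (close₁ N (ℕP.m⊔n≤o⇒m≤o N₁ N₂ N₀≤N))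
                                          (close₂ N (ℕP.m⊔n≤o⇒n≤o N₁ N₂ N₀≤N)))
    where
    regroup : ∀ x y → (x - L) + (y - M) ≡ (x + y) - (L + M)
    regroup x y = solve 4 (λ x y L M → (x :- L) :+ (y :- M) := (x :+ y) :- (L :+ M)) refl x y L M

  PAdicLimit-*ˡ : ∀ z s L → PAdicLimit p s L → PAdicLimit p (λ N → ℤ→ℚ z * s N) (ℤ→ℚ z * L)
  PAdicLimit-*ˡ z s L s→L m with s→L m
  ... | N₀ , close = N₀ , λ N N₀≤N →
    subst (padicDivBy p m) (distrib (s N)) (padicDivBy-*ˡ m z (s N - L) (close N N₀≤N))
    where
    distrib : ∀ x → ℤ→ℚ z * (x - L) ≡ ℤ→ℚ z * x - ℤ→ℚ z * L
    distrib x = solve 3 (λ Z x L → Z :* (x :- L) := Z :* x :- Z :* L) refl (ℤ→ℚ z) x L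

  PAdicLimit-Σ : ∀ K (s : ℕ → ℕ → ℚ) (L : ℕ → ℚ) → (∀ j → j < K → PAdicLimit p (s j) (L j)) →
                 PAdicLimit p (λ N → Σ< K (λ j → s j N)) (Σ< K L)
  PAdicLimit-Σ zero    s L _   = PAdicLimit-const 0ℚ
  PAdicLimit-Σ (suc K) s L s→L =
    PAdicLimit-+ (λ N → Σ< K (λ j → s j N)) (Σ< K L) (s K) (L K)
      (PAdicLimit-Σ K s L (λ j j<K → s→L j (ℕP.m<n⇒m<1+n j<K))) (s→L K ℕP.≤-refl)

  PAdicLimit-cancelˡ-+ : ∀ s L t M → PAdicLimit p s L → PAdicLimit p (λ N → s N + t N) (L + M) → PAdicLimit p t M
  PAdicLimit-cancelˡ-+ s L t M s→L s+t→L+M m with s→L m | s+t→L+M m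
  ... | N₁ , close₁ | N₂ , close₂ = N₁ ⊔ N₂ , λ N N₀≤N →
    subst (padicDivBy p m) (regroup (s N) (t N))
      (padicDivBy-+ m ((s N + t N) - (L + M)) (- (s N - L)) (close₂ N (ℕP.m⊔n≤o⇒n≤o N₁ N₂ N₀≤N))
        (padicDivBy-neg m (s N - L) (close₁ N (ℕP.m⊔n≤o⇒m≤o N₁ N₂ N₀≤N))))
    where
    regroup : ∀ x y → ((x + y) - (L + M)) + - (x - L) ≡ y - M
    regroup x y = solve 4 (λ x y L M → ((x :+ y) :- (L :+ M)) :+ (:- (x :- L)) := y :- M) refl x y L M

  PAdicLimit-*-cancel : ∀ c .{{_ : ℕ.NonZero c}} s L →
                        PAdicLimit p (λ N → ℕ→ℚ c * s N) (ℕ→ℚ c * L) → PAdicLimit p s L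
  PAdicLimit-*-cancel c s L cs→cL m with p-power-split c (ℕ.>-nonZero⁻¹ c)
  ... | e , t , c≡pᵉt , p∤t with cs→cL (m ℕ.+ e)
  ...   | N₀ , close = N₀ , λ N N₀≤N →
    padicDivBy-cancel m e t (s N - L) p∤t (subst (padicDivBy p (m ℕ.+ e)) (factor (s N)) (close N N₀≤N))
    where
    factor : ∀ x → ℕ→ℚ c * x - ℕ→ℚ c * L ≡ ℕ→ℚ (p ^ e ℕ.* t) * (x - L)
    factor x = trans (solve 3 (λ C x L → C :* x :- C :* L := C :* (x :- L)) refl (ℕ→ℚ c) x L)
                     (cong (λ c → ℕ→ℚ c * (x - L)) c≡pᵉt)

  PAdicLimit-[pᴺ]^[1+n] : ∀ n → PAdicLimit p (λ N → ℕ→ℚ ((p ^ N) ^ suc n)) 0ℚ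
  PAdicLimit-[pᴺ]^[1+n] n m = m , λ N m≤N →
    subst (padicDivBy p m) (sym (ℚP.+-identityʳ (ℕ→ℚ ((p ^ N) ^ suc n))))
      (subst (λ e → padicDivBy p m (ℕ→ℚ e)) (sym (ℕP.^-*-assoc p N (suc n)))
        (padicDivBy-p^ m (N ℕ.* suc n) (ℕP.≤-trans m≤N (ℕP.m≤m*n N (suc n)))))

module PolynomialIdentities where
  open import Data.Nat as ℕ using (ℕ; zero; suc; _≤_; _∸_; _^_; _!)
  import Data.Nat.Properties as ℕP
  open import Data.Nat.Combinatorics using (_C_)
  open import Data.Rational using (ℚ; 1ℚ; _*_)
  import Data.Rational.Properties as ℚP
  open import Data.Rational.Solver using (module +-*-Solver)
  open import Relation.Binary.PropositionalEquality
  open +-*-Solver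
  open RationalEmbedding
  open NatCombinatorics
  open StirlingCoefficients
  open RationalSums

  monomial : ℕ → ℕ → ℚ
  monomial n x = ℕ→ℚ (x ^ n)

  ℕ→ℚ-Σ[aₙxⁿ] : ∀ K (a : ℕ → ℕ) x →
                ℕ→ℚ (Σℕ K (λ n → a n ℕ.* x ^ n)) ≡ Σ< K (λ n → ℕ→ℚ (a n) * monomial n x)
  ℕ→ℚ-Σ[aₙxⁿ] K a x = trans (ℕ→ℚ-Σℕ K _) (Σ<-cong K (λ n _ → ℕ→ℚ-* (a n) (x ^ n)))

  Π[1+jx]≡Σ[stirlingCoeff*xⁿ] : ∀ k x →
    Π1 k (λ j → ℕ→ℚ (suc (j ℕ.* x))) ≡ Σ< (suc k) (λ n → ℕ→ℚ (stirlingCoeff k n) * monomial n x)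
  Π[1+jx]≡Σ[stirlingCoeff*xⁿ] zero    x = refl
  Π[1+jx]≡Σ[stirlingCoeff*xⁿ] (suc k) x = begin
    Π1 k (λ j → ℕ→ℚ (suc (j ℕ.* x))) * ℕ→ℚ (1 ℕ.+ suc k ℕ.* x)
      ≡⟨ cong (_* ℕ→ℚ (1 ℕ.+ suc k ℕ.* x))
              (trans (Π[1+jx]≡Σ[stirlingCoeff*xⁿ] k x) (sym (ℕ→ℚ-Σ[aₙxⁿ] (suc k) (stirlingCoeff k) x))) ⟩
    ℕ→ℚ (Σℕ (suc k) (λ n → stirlingCoeff k n ℕ.* x ^ n)) * ℕ→ℚ (1 ℕ.+ suc k ℕ.* x)
      ≡⟨ sym (ℕ→ℚ-* (Σℕ (suc k) (λ n → stirlingCoeff k n ℕ.* x ^ n)) _) ⟩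
    ℕ→ℚ (Σℕ (suc k) (λ n → stirlingCoeff k n ℕ.* x ^ n) ℕ.* (1 ℕ.+ suc k ℕ.* x))
      ≡⟨ cong ℕ→ℚ (Σ[aₙxⁿ]*[1+cx] k (suc k) x (stirlingCoeff k) (stirlingCoeff (suc k))
           (stirlingCoeff-beyond-degree k)
           (trans (stirlingCoeff-constant (suc k)) (sym (stirlingCoeff-constant k)))
           (stirlingCoeff-rec k)) ⟩
    ℕ→ℚ (Σℕ (suc (suc k)) (λ n → stirlingCoeff (suc k) n ℕ.* x ^ n))
      ≡⟨ ℕ→ℚ-Σ[aₙxⁿ] (suc (suc k)) (stirlingCoeff (suc k)) x ⟩
    Σ< (suc (suc k)) (λ n → ℕ→ℚ (stirlingCoeff (suc k) n) * monomial n x) ∎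
    where open ≡-Reasoning

  k!*harmBinom[k,k∸n]≡stirlingCoeff : ∀ k n → n ≤ k →
                                      ℕ→ℚ (k !) * harmBinom k (k ∸ n) ≡ ℕ→ℚ (stirlingCoeff k n)
  k!*harmBinom[k,k∸n]≡stirlingCoeff k n n≤k = begin
    ℕ→ℚ (k !) * (inv (k !) * S)   ≡⟨ sym (ℚP.*-assoc (ℕ→ℚ (k !)) (inv (k !)) S) ⟩
    ℕ→ℚ (k !) * inv (k !) * S     ≡⟨ cong (_* S) (inv-inverseʳ (k !) {{k ℕP.!≢0}}) ⟩
    1ℚ * S                        ≡⟨ ℚP.*-identityˡ S ⟩
    S                             ≡⟨ cong (λ m → ℕ→ℚ (stirling1 (suc k) m)) (sym (ℕP.+-∸-assoc 1 n≤k)) ⟩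
    ℕ→ℚ (stirlingCoeff k n)       ∎
    where
    open ≡-Reasoning
    S = ℕ→ℚ (stirling1 (suc k) (suc (k ∸ n)))

  Σ[[n+1]Cj*avg[xʲ]]≡Mⁿ : ∀ n M .{{_ : ℕ.NonZero M}} →
    Σ< (suc n) (λ j → ℕ→ℚ (suc n C j) * (inv M * Σ< M (monomial j))) ≡ ℕ→ℚ (M ^ n)
  Σ[[n+1]Cj*avg[xʲ]]≡Mⁿ n M = begin
    Σ< (suc n) (λ j → ℕ→ℚ (suc n C j) * (inv M * Σ< M (monomial j)))
      ≡⟨ Σ<-cong (suc n) (λ j _ → *-left-comm (ℕ→ℚ (suc n C j)) (inv M) (Σ< M (monomial j))) ⟩
    Σ< (suc n) (λ j → inv M * (ℕ→ℚ (suc n C j) * Σ< M (monomial j)))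
      ≡⟨ sym (Σ<-distribˡ-* (suc n) (inv M) _) ⟩
    inv M * Σ< (suc n) (λ j → ℕ→ℚ (suc n C j) * Σ< M (monomial j))
      ≡⟨ cong (inv M *_) (sym (trans (ℕ→ℚ-Σℕ (suc n) _) (Σ<-cong (suc n) cast))) ⟩
    inv M * ℕ→ℚ (Σℕ (suc n) (λ j → (suc n C j) ℕ.* Σℕ M (λ x → x ^ j)))
      ≡⟨ cong (λ m → inv M * ℕ→ℚ m) (Σ[[n+1]Cj*Σxʲ]≡Mⁿ⁺¹ n M) ⟩
    inv M * ℕ→ℚ (M ℕ.* M ^ n)
      ≡⟨ cong (inv M *_) (ℕ→ℚ-* M (M ^ n)) ⟩
    inv M * (ℕ→ℚ M * ℕ→ℚ (M ^ n))
      ≡⟨ sym (ℚP.*-assoc (inv M) (ℕ→ℚ M) _) ⟩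
    inv M * ℕ→ℚ M * ℕ→ℚ (M ^ n)
      ≡⟨ cong (_* ℕ→ℚ (M ^ n)) (inv-inverseˡ M) ⟩
    1ℚ * ℕ→ℚ (M ^ n)
      ≡⟨ ℚP.*-identityˡ _ ⟩
    ℕ→ℚ (M ^ n) ∎
    where
    open ≡-Reasoning
    *-left-comm : ∀ a b c → a * (b * c) ≡ b * (a * c)
    *-left-comm = solve 3 (λ a b c → a :* (b :* c) := b :* (a :* c)) refl
    cast : ∀ j → j ℕ.< suc n →
           ℕ→ℚ ((suc n C j) ℕ.* Σℕ M (λ x → x ^ j)) ≡ ℕ→ℚ (suc n C j) * Σ< M (monomial j)
    cast j _ = trans (ℕ→ℚ-* (suc n C j) _) (cong (ℕ→ℚ (suc n C j) *_) (ℕ→ℚ-Σℕ M (λ x → x ^ j)))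

module VolkenbornIntegrals (p : ℕ) (p-prime : Prime p) where
  open import Data.Nat using (zero; suc; _<_; _^_)
  open import Data.Nat.Combinatorics using (_C_)
  open import Data.Nat.Induction using (<-rec)
  open import Data.Integer using (+_)
  open import Data.Rational using (ℚ; 0ℚ; 1ℚ; _*_)
  open import Data.Rational.Solver using (module +-*-Solver)
  open import Relation.Binary.PropositionalEquality
  open +-*-Solver
  open RationalSums
  open BernoulliNumbers
  open PolynomialIdentities
  open PAdicValuation p p-prime using (pᵉ≢0)
  open PAdicLimits p p-prime

  volkenbornSum-Σ : ∀ K (g : ℕ → ℕ → ℚ) N →
    volkenbornSum p (λ x → Σ< K (λ n → g n x)) N ≡ Σ< K (λ n → volkenbornSum p (g n) N)
  volkenbornSum-Σ K g N = trans (cong (inv (p ^ N) *_) (Σ<-comm (p ^ N) K g)) (Σ<-distribˡ-* K (inv (p ^ N)) _)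

  volkenbornSum-*ˡ : ∀ c g N → volkenbornSum p (λ x → c * g x) N ≡ c * volkenbornSum p g N
  volkenbornSum-*ˡ c g N = trans (cong (inv (p ^ N) *_) (sym (Σ<-distribˡ-* (p ^ N) c g)))
    (solve 3 (λ i c s → i :* (c :* s) := c :* (i :* s)) refl (inv (p ^ N)) c (Σ< (p ^ N) g))

  VolkenbornIntegral-cong : ∀ {f g} L → (∀ x → f x ≡ g x) → VolkenbornIntegral p f L → VolkenbornIntegral p g L
  VolkenbornIntegral-cong L f≡g =
    PAdicLimit-cong L (λ N → cong (inv (p ^ N) *_) (Σ<-cong (p ^ N) (λ x _ → f≡g x)))

  VolkenbornIntegral-*ˡ : ∀ z g L → VolkenbornIntegral p g L →
                          VolkenbornIntegral p (λ x → ℤ→ℚ z * g x) (ℤ→ℚ z * L)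
  VolkenbornIntegral-*ˡ z g L ∫g≡L =
    PAdicLimit-cong (ℤ→ℚ z * L) (λ N → sym (volkenbornSum-*ˡ (ℤ→ℚ z) g N))
      (PAdicLimit-*ˡ z (volkenbornSum p g) L ∫g≡L)

  VolkenbornIntegral-Σ : ∀ K (g : ℕ → ℕ → ℚ) (L : ℕ → ℚ) →
    (∀ n → n < K → VolkenbornIntegral p (g n) (L n)) →
    VolkenbornIntegral p (λ x → Σ< K (λ n → g n x)) (Σ< K L)
  VolkenbornIntegral-Σ K g L ∫g≡L =
    PAdicLimit-cong (Σ< K L) (λ N → sym (volkenbornSum-Σ K g N))
      (PAdicLimit-Σ K (λ n → volkenbornSum p (g n)) L ∫g≡L)

  VolkenbornIntegral-xⁿ : ∀ n → VolkenbornIntegral p (monomial n) (bernoulli n)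
  VolkenbornIntegral-xⁿ = <-rec _ moment
    where
    R : ℕ → ℕ → ℚ
    R j = volkenbornSum p (monomial j)

    moment : ∀ n → (∀ {j} → j < n → VolkenbornIntegral p (monomial j) (bernoulli j)) →
             VolkenbornIntegral p (monomial n) (bernoulli n)
    moment zero    _  = PAdicLimit-cong 1ℚ R₀≡1 (PAdicLimit-const 1ℚ)
      where
      R₀≡1 : ∀ N → 1ℚ ≡ R 0 N
      R₀≡1 N = trans (sym (Σ[[n+1]Cj*avg[xʲ]]≡Mⁿ 0 (p ^ N) {{pᵉ≢0 N}}))
                     (solve 1 (λ r → con 0ℚ :+ con 1ℚ :* r := r) refl (R 0 N))
    moment (suc n) ih = PAdicLimit-*-cancel (suc (suc n)) (R (suc n)) (bernoulli (suc n))
      (subst (λ c → PAdicLimit p (λ N → ℕ→ℚ c * R (suc n) N) (ℕ→ℚ c * bernoulli (suc n)))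
             ([n+1]Cn≡n+1 (suc n)) top)
      where
      c : ℕ → ℚ
      c j = ℕ→ℚ (suc (suc n) C j)
      ΣcR : ℕ → ℕ → ℚ
      ΣcR K N = Σ< K (λ j → c j * R j N)
      ΣcB : ℕ → ℚ
      ΣcB K = Σ< K (λ j → c j * bernoulli j)
      lower : PAdicLimit p (ΣcR (suc n)) (ΣcB (suc n))
      lower = PAdicLimit-Σ (suc n) (λ j N → c j * R j N) (λ j → c j * bernoulli j)
                (λ j j<n+1 → PAdicLimit-*ˡ (+ (suc (suc n) C j)) (R j) (bernoulli j) (ih j<n+1))
      whole : PAdicLimit p (ΣcR (suc (suc n))) (ΣcB (suc (suc n)))
      whole = subst (PAdicLimit p (ΣcR (suc (suc n)))) (sym (Σ[[n+2]Cj*Bⱼ]≡0 n))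
                (PAdicLimit-cong 0ℚ (λ N → sym (Σ[[n+1]Cj*avg[xʲ]]≡Mⁿ (suc n) (p ^ N) {{pᵉ≢0 N}}))
                  (PAdicLimit-[pᴺ]^[1+n] n))
      top : PAdicLimit p (λ N → c (suc n) * R (suc n) N) (c (suc n) * bernoulli (suc n))
      top = PAdicLimit-cancelˡ-+ (ΣcR (suc n)) (ΣcB (suc n))
              (λ N → c (suc n) * R (suc n) N) (c (suc n) * bernoulli (suc n)) lower whole

open import Data.Nat using (ℕ; suc; _!; _∸_; _*_; _<_)
open import Data.Nat.Primality using (Prime)
open import Data.Rational as ℚ using ()
open import Relation.Binary.PropositionalEquality using (_≢_; _≡_; sym; cong; subst)
open import Data.Nat.Properties using (≤-pred)
open import Data.Integer using (+_)
open RationalSums using (Σ<-cong)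
open StirlingCoefficients using (stirlingCoeff)
open PolynomialIdentities

mainTheorem10 : (p : ℕ) → Prime p → p ≢ 2 → (k : ℕ) →
    VolkenbornIntegral p
    (λ x → Π1 k (λ j → ℕ→ℚ (suc (j * x))))
    (Σ< (suc k) (λ n → ℕ→ℚ (k !) ℚ.* harmBinom k (k ∸ n) ℚ.* bernoulli n))
-- ∫ xⁿ dμ₁ = Bₙ holds for every prime.
mainTheorem10 p p-prime _ k =
  subst (VolkenbornIntegral p (λ x → Π1 k (λ j → ℕ→ℚ (suc (j * x))))) (Σ<-cong (suc k) harmonic-form)
    (VolkenbornIntegral-cong _ (λ x → sym (Π[1+jx]≡Σ[stirlingCoeff*xⁿ] k x))
      (VolkenbornIntegral-Σ (suc k) (λ n x → ℕ→ℚ (stirlingCoeff k n) ℚ.* monomial n x)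
        (λ n → ℕ→ℚ (stirlingCoeff k n) ℚ.* bernoulli n)
        (λ n _ → VolkenbornIntegral-*ˡ (+ stirlingCoeff k n) (monomial n) (bernoulli n) (VolkenbornIntegral-xⁿ n))))
  where
  open VolkenbornIntegrals p p-prime
  harmonic-form : ∀ n → n < suc k →
    ℕ→ℚ (stirlingCoeff k n) ℚ.* bernoulli n ≡ ℕ→ℚ (k !) ℚ.* harmBinom k (k ∸ n) ℚ.* bernoulli n
  harmonic-form n n<k+1 = cong (ℚ._* bernoulli n) (sym (k!*harmBinom[k,k∸n]≡stirlingCoeff k n (≤-pred n<k+1)))
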